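{- Let $n \ge 5$ and let $S$ be a set of transpositions generating $S_n$. Let $X = \mathrm{Cay}(S_n,S)$, let $G = \mathrm{Aut}(X)$, let $G_e$ be the stabilizer in $G$ of the identity vertex $e$, and let $L_e \le G_e$ be the subgroup of automorphisms fixing $e$ and each of its neighbors (i.e., fixing every element of $S$). Let $\mathrm{Aut}(S_n,S)$ be the group of group automorphisms of $S_n$ that map $S$ onto itself, regarded as a group of permutations of the vertex set $S_n$ of $X$. Then $G_e = L_e \rtimes \mathrm{Aut}(S_n,S)$; that is, $L_e$ is a normal subgroup of $G_e$, $G_e = L_e\,\mathrm{Aut}(S_n,S)$, and $L_e \cap \mathrm{Aut}(S_n,S) = 1$.
   Context: For a group $H$ and a subset $S \subseteq H$ with $1 \notin S$ and $S = S^{ -1}$, the Cayley graph $\mathrm{Cay}(H,S)$ is the simple undirected graph with vertex set $H$ and edge set $\{\{h, sh\} : h \in H, s \in S\}$; the neighbors of the identity vertex $e$ are exactly the elements of $S$. A set of transpositions generating $S_n$ means a set $S$ of transpositions of $\{1,\ldots,n\}$ whose generated subgroup is the full symmetric group $S_n$. Every group automorphism of $S_n$ mapping $S$ onto $S$ is an automorphism of $\mathrm{Cay}(S_n,S)$ fixing $e$, so $\mathrm{Aut}(S_n,S) \le G_e$. -}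

module Defs where

open import Data.Nat using (ℕ)
open import Data.Fin using (Fin)
open import Data.Fin.Permutation using (Permutation′; _∘ₚ_; transpose; id; _≈_)
open import Data.List using (List; foldr)
open import Data.List.Membership.Propositional using (_∈_)
open import Data.Product using (_×_; _,_; Σ; ∃; ∃-syntax)
open import Relation.Binary.PropositionalEquality using (_≡_)
open import Relation.Nullary using (¬_)

Sym : ℕ → Set
Sym n = Permutation′ n

-- Group multiplication σ · τ = "σ after τ" (stdlib's _∘ₚ_ is diagrammatic).
_·_ : ∀ {n} → Sym n → Sym n → Sym n
σ · τ = τ ∘ₚ σ

infixl 7 _·_

-- A set of transpositions, given by a list of pairs (i , j) with i ≠ j;
-- the set S is { transpose i j | (i , j) in the list }.
TranspositionSet : ℕ → Set
TranspositionSet n = List (Fin n × Fin n)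

IsTranspositionSet : ∀ {n} → TranspositionSet n → Set
IsTranspositionSet T = ∀ {i j} → (i , j) ∈ T → ¬ (i ≡ j)

_∈S_ : ∀ {n} → Sym n → TranspositionSet n → Set
σ ∈S T = ∃[ i ] ∃[ j ] ((i , j) ∈ T × σ ≈ transpose i j)

wordProd : ∀ {n} → List (Fin n × Fin n) → Sym n
wordProd = foldr (λ { (i , j) π → transpose i j · π }) id

-- S generates S_n: every permutation is a product of elements of S
-- (S = S⁻¹, so products of generators suffice).
Generates : ∀ {n} → TranspositionSet n → Set
Generates {n} T = (σ : Sym n) →
  ∃[ w ] ((∀ {p} → p ∈ w → p ∈ T) × σ ≈ wordProd w)

Adj : ∀ {n} → TranspositionSet n → Sym n → Sym n → Set
Adj T x y = ∃[ s ] (s ∈S T × y ≈ s · x)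

record VertexPerm (n : ℕ) : Set where
  field
    to      : Sym n → Sym n
    from    : Sym n → Sym n
    to-cong   : ∀ {x y} → x ≈ y → to x ≈ to y
    from-cong : ∀ {x y} → x ≈ y → from x ≈ from y
    to-from : ∀ x → to (from x) ≈ x
    from-to : ∀ x → from (to x) ≈ x

open VertexPerm public

record GraphAut {n} (T : TranspositionSet n) : Set where
  field
    perm     : VertexPerm n
    to-adj   : ∀ {x y} → Adj T x y → Adj T (to perm x) (to perm y)
    from-adj : ∀ {x y} → Adj T x y → Adj T (from perm x) (from perm y)

open GraphAut public

record StabAut {n} (T : TranspositionSet n) : Set where
  field
    aut   : GraphAut T
    fix-e : to (perm aut) id ≈ id

open StabAut public

record LocalAut {n} (T : TranspositionSet n) : Set where
  field
    stab  : StabAut T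
    fix-S : ∀ s → s ∈S T → to (perm (aut stab)) s ≈ s

open LocalAut public

record GroupAutS {n} (T : TranspositionSet n) : Set where
  field
    gperm   : VertexPerm n
    hom     : ∀ x y → to gperm (x · y) ≈ to gperm x · to gperm y
    maps-S  : ∀ s → s ∈S T → to gperm s ∈S T
    onto-S  : ∀ s → s ∈S T → ∃[ t ] (t ∈S T × to gperm t ≈ s)

open GroupAutS public

stabMap : ∀ {n} {T : TranspositionSet n} → StabAut T → Sym n → Sym n
stabMap f = to (perm (aut f))

stabInv : ∀ {n} {T : TranspositionSet n} → StabAut T → Sym n → Sym n
stabInv f = from (perm (aut f))

localMap : ∀ {n} {T : TranspositionSet n} → LocalAut T → Sym n → Sym n
localMap l = stabMap (stab l)

gautMap : ∀ {n} {T : TranspositionSet n} → GroupAutS T → Sym n → Sym n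
gautMap a = to (gperm a)

-- An automorphism f of Cay(S_n , S) fixing e permutes the neighbours S of e and preserves their
-- common-neighbour structure: two distinct generators are disjoint transpositions exactly when they have a
-- unique common neighbour besides e, and three generators through one point have a common neighbour besides e
-- exactly when they form a triangle (i a), (i c), (a c) rather than a star (i a), (i b), (i c).  Hence f maps
-- the generators moving a point i onto the generators moving a point π i, π is a permutation, and f agrees
-- on S with conjugation by π.  That conjugation lies in Aut(S_n , S), and f after its inverse fixes S.
-- Normality of L_e is immediate, and L_e ∩ Aut(S_n , S) = 1 since a group automorphism fixing the generating
-- set S is trivial.

module Submission where

open import Defs
open import Data.Nat using (ℕ; _≤_; _≥_; s≤s; z≤n)
open import Data.Nat.Properties using (≤-trans)
open import Data.Fin using (Fin; zero; suc)
open import Data.Fin.Properties using (_≟_; all?)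
open import Data.Fin.Permutation
  using (_⟨$⟩ʳ_; _⟨$⟩ˡ_; transpose; id; flip; _≈_; permutation; inverseˡ; inverseʳ)
open import Data.Empty using (⊥; ⊥-elim)
open import Data.Product using (_×_; _,_; ∃-syntax; proj₁; proj₂)
open import Data.List using (_∷_; [])
open import Data.List.Membership.Propositional using (_∈_; find; lose)
open import Data.List.Relation.Unary.Any using (here; there; any?)
open import Data.Sum using (_⊎_; inj₁; inj₂)
open import Function using (_∘_)
open import Relation.Nullary using (¬_; Dec; yes; no; ¬?; _×-dec_)
open import Relation.Binary.PropositionalEquality
  using (_≡_; _≢_; refl; sym; trans; cong; subst; ≢-sym; module ≡-Reasoning)

private variable
  n : ℕ
  a b c d i j k m p q x y : Fin n
  σ ρ τ s t r u v s₀ : Sym n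

-- Transpositions acting on points

swap : Fin n → Fin n → Fin n → Fin n
swap i j k = transpose i j ⟨$⟩ʳ k

swap-fst : (i j : Fin n) → swap i j i ≡ j
swap-fst i j with i ≟ i
... | yes _ = refl
... | no i≢i = ⊥-elim (i≢i refl)

swap-snd : (i j : Fin n) → swap i j j ≡ i
swap-snd i j with j ≟ i
... | yes j≡i = j≡i
... | no _ with j ≟ j
...   | yes _ = refl
...   | no j≢j = ⊥-elim (j≢j refl)

swap-other : k ≢ i → k ≢ j → swap i j k ≡ k
swap-other {k = k} {i} {j} k≢i k≢j with k ≟ i
... | yes k≡i = ⊥-elim (k≢i k≡i)
... | no _ with k ≟ j
...   | yes k≡j = ⊥-elim (k≢j k≡j)
...   | no _ = refl

data Location (k i j : Fin n) : Set where
  at-fst    : k ≡ i → Location k i j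
  at-snd    : k ≡ j → Location k i j
  elsewhere : k ≢ i → k ≢ j → Location k i j

locate : (k i j : Fin n) → Location k i j
locate k i j with k ≟ i | k ≟ j
... | yes k≡i | _       = at-fst k≡i
... | no _    | yes k≡j = at-snd k≡j
... | no k≢i  | no k≢j  = elsewhere k≢i k≢j

swap-comm : (i j k : Fin n) → swap i j k ≡ swap j i k
swap-comm i j k with locate k i j
... | at-fst refl = trans (swap-fst k j) (sym (swap-snd j k))
... | at-snd refl = trans (swap-snd i k) (sym (swap-fst k i))
... | elsewhere k≢i k≢j = trans (swap-other k≢i k≢j) (sym (swap-other k≢j k≢i))

swap-involutive : (i j k : Fin n) → swap i j (swap i j k) ≡ k
swap-involutive i j k = trans (cong (swap i j) (swap-comm i j k)) (inverseʳ (transpose i j))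

swap-conjugate : (π : Sym n) (x y k : Fin n) →
  π ⟨$⟩ʳ swap x y (π ⟨$⟩ˡ k) ≡ swap (π ⟨$⟩ʳ x) (π ⟨$⟩ʳ y) k
swap-conjugate π x y k with locate k (π ⟨$⟩ʳ x) (π ⟨$⟩ʳ y)
... | at-fst refl = begin
  π ⟨$⟩ʳ swap x y (π ⟨$⟩ˡ (π ⟨$⟩ʳ x)) ≡⟨ cong (λ z → π ⟨$⟩ʳ swap x y z) (inverseˡ π) ⟩
  π ⟨$⟩ʳ swap x y x                   ≡⟨ cong (π ⟨$⟩ʳ_) (swap-fst x y) ⟩
  π ⟨$⟩ʳ y                            ≡⟨ sym (swap-fst (π ⟨$⟩ʳ x) (π ⟨$⟩ʳ y)) ⟩
  swap (π ⟨$⟩ʳ x) (π ⟨$⟩ʳ y) (π ⟨$⟩ʳ x) ∎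
  where open ≡-Reasoning
... | at-snd refl = begin
  π ⟨$⟩ʳ swap x y (π ⟨$⟩ˡ (π ⟨$⟩ʳ y)) ≡⟨ cong (λ z → π ⟨$⟩ʳ swap x y z) (inverseˡ π) ⟩
  π ⟨$⟩ʳ swap x y y                   ≡⟨ cong (π ⟨$⟩ʳ_) (swap-snd x y) ⟩
  π ⟨$⟩ʳ x                            ≡⟨ sym (swap-snd (π ⟨$⟩ʳ x) (π ⟨$⟩ʳ y)) ⟩
  swap (π ⟨$⟩ʳ x) (π ⟨$⟩ʳ y) (π ⟨$⟩ʳ y) ∎
  where open ≡-Reasoning
... | elsewhere k≢πx k≢πy = begin
  π ⟨$⟩ʳ swap x y (π ⟨$⟩ˡ k) ≡⟨ cong (π ⟨$⟩ʳ_) (swap-other (k≢πx ∘ moved) (k≢πy ∘ moved)) ⟩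
  π ⟨$⟩ʳ (π ⟨$⟩ˡ k)          ≡⟨ inverseʳ π ⟩
  k                          ≡⟨ sym (swap-other k≢πx k≢πy) ⟩
  swap (π ⟨$⟩ʳ x) (π ⟨$⟩ʳ y) k ∎
  where
  open ≡-Reasoning
  moved : ∀ {z} → π ⟨$⟩ˡ k ≡ z → k ≡ π ⟨$⟩ʳ z
  moved refl = sym (inverseʳ π)

swap-swap : (a b x y k : Fin n) →
  swap a b (swap x y k) ≡ swap (swap a b x) (swap a b y) (swap a b k)
swap-swap a b x y k =
  trans (cong (λ z → swap a b (swap x y z)) (sym (inverseˡ (transpose a b) {k})))
        (swap-conjugate (transpose a b) x y (swap a b k))

swap-swap-at : swap a b x ≡ p → swap a b y ≡ q → ∀ k →
  swap a b (swap x y k) ≡ swap p q (swap a b k)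
swap-swap-at {a = a} {b} {x} {y = y} refl refl k = swap-swap a b x y k

swap-≡-fixed : swap i j k ≡ m → m ≢ i → m ≢ j → k ≡ m
swap-≡-fixed {i = i} {j} {k} refl m≢i m≢j =
  trans (sym (swap-involutive i j k)) (swap-other m≢i m≢j)

record Distinct₃ (a b c : Fin n) : Set where
  field
    a≢b : a ≢ b
    a≢c : a ≢ c
    b≢c : b ≢ c

record Distinct₄ (a b c d : Fin n) : Set where
  field
    a≢b : a ≢ b
    a≢c : a ≢ c
    a≢d : a ≢ d
    b≢c : b ≢ c
    b≢d : b ≢ d
    c≢d : c ≢ d

_≈?_ : (σ ρ : Sym n) → Dec (σ ≈ ρ)
σ ≈? ρ = all? (λ k → σ ⟨$⟩ʳ k ≟ ρ ⟨$⟩ʳ k)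

≈-stable : (σ ρ : Sym n) → ¬ ¬ σ ≈ ρ → σ ≈ ρ
≈-stable σ ρ ¬σ≉ρ with σ ≈? ρ
... | yes σ≈ρ = σ≈ρ
... | no σ≉ρ = ⊥-elim (¬σ≉ρ σ≉ρ)

record Moves (σ : Sym n) (k : Fin n) : Set where
  constructor moves
  field moved : σ ⟨$⟩ʳ k ≢ k

open Moves

moves? : (σ : Sym n) (k : Fin n) → Dec (Moves σ k)
moves? σ k with σ ⟨$⟩ʳ k ≟ k
... | yes fixed = no λ m → moved m fixed
... | no σk≢k = yes (moves σk≢k)

fixed-if-not-moved : ¬ Moves σ k → σ ⟨$⟩ʳ k ≡ k
fixed-if-not-moved {σ = σ} {k} σ↛k with σ ⟨$⟩ʳ k ≟ k
... | yes fixed = fixed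
... | no σk≢k = ⊥-elim (σ↛k (moves σk≢k))

moves-≈ : σ ≈ ρ → Moves σ k → Moves ρ k
moves-≈ σ≈ρ (moves σk≢k) = moves λ ρk≡k → σk≢k (trans (σ≈ρ _) ρk≡k)

transpose-moves : Moves (transpose x y) k → k ≡ x ⊎ k ≡ y
transpose-moves {x = x} {y} {k} (moves m) with locate k x y
... | at-fst k≡x = inj₁ k≡x
... | at-snd k≡y = inj₂ k≡y
... | elsewhere k≢x k≢y = ⊥-elim (m (swap-other k≢x k≢y))

transpose-moves-fst : x ≢ y → Moves (transpose x y) x
transpose-moves-fst {x = x} {y} x≢y = moves λ y≡x → x≢y (trans (sym y≡x) (swap-fst x y))

transpose-moves-snd : x ≢ y → Moves (transpose x y) y
transpose-moves-snd {x = x} {y} x≢y = moves λ x≡y → x≢y (trans (sym (swap-snd x y)) x≡y)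

record IsTransposition (σ : Sym n) : Set where
  constructor transposition
  field
    fst snd    : Fin n
    fst≢snd    : fst ≢ snd
    ≈transpose : σ ≈ transpose fst snd

module Tr = IsTransposition

transpose-isTransposition : x ≢ y → IsTransposition (transpose x y)
transpose-isTransposition {x = x} {y} x≢y = transposition x y x≢y λ _ → refl

transposition-involutive : IsTransposition σ → ∀ k → σ ⟨$⟩ʳ (σ ⟨$⟩ʳ k) ≡ k
transposition-involutive {σ = σ} (transposition x y _ σ≈xy) k =
  trans (σ≈xy _) (trans (cong (swap x y) (σ≈xy k)) (swap-involutive x y k))

transposition-moves : (σ-tr : IsTransposition σ) → Moves σ k →
  k ≡ Tr.fst σ-tr ⊎ k ≡ Tr.snd σ-tr
transposition-moves {σ = σ} (transposition x y _ σ≈xy) σ⇝k = transpose-moves (moves-≈ {σ = σ} σ≈xy σ⇝k)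

transposition-moves-fst : (σ-tr : IsTransposition σ) → Moves σ (Tr.fst σ-tr)
transposition-moves-fst {σ = σ} (transposition x y x≢y σ≈xy) =
  moves-≈ {ρ = σ} (λ k → sym (σ≈xy k)) (transpose-moves-fst x≢y)

transposition-moves-snd : (σ-tr : IsTransposition σ) → Moves σ (Tr.snd σ-tr)
transposition-moves-snd {σ = σ} (transposition x y x≢y σ≈xy) =
  moves-≈ {ρ = σ} (λ k → sym (σ≈xy k)) (transpose-moves-snd x≢y)

transposition-moves-image : IsTransposition σ → Moves σ k → Moves σ (σ ⟨$⟩ʳ k)
transposition-moves-image {σ = σ} {k} σ-tr (moves σk≢k) =
  moves λ σσk≡σk → σk≢k (trans (sym σσk≡σk) (transposition-involutive σ-tr k))

transposition-through : IsTransposition σ → σ ⟨$⟩ʳ k ≡ m → k ≢ m → σ ≈ transpose k m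
transposition-through {σ = σ} {k} σ-tr@(transposition x y _ σ≈xy) σk≡m k≢m
  with transposition-moves σ-tr (moves λ σk≡k → k≢m (trans (sym σk≡k) σk≡m))
... | inj₁ refl = subst (λ z → σ ≈ transpose k z) (trans (sym (swap-fst k y)) (trans (sym (σ≈xy k)) σk≡m)) σ≈xy
... | inj₂ refl = subst (λ z → σ ≈ transpose k z) (trans (sym (swap-snd x k)) (trans (sym (σ≈xy k)) σk≡m))
                    λ z → trans (σ≈xy z) (swap-comm x k z)

transposition-at : IsTransposition σ → Moves σ k → σ ≈ transpose k (σ ⟨$⟩ʳ k)
transposition-at σ-tr (moves σk≢k) = transposition-through σ-tr refl (≢-sym σk≢k)

transposition-determined : IsTransposition σ → Moves σ p → Moves σ q → p ≢ q → σ ≈ transpose p q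
transposition-determined {σ = σ} {p} {q} σ-tr σ⇝p σ⇝q p≢q
  with transpose-moves (moves-≈ {σ = σ} (transposition-at σ-tr σ⇝p) σ⇝q)
... | inj₁ q≡p = ⊥-elim (p≢q (sym q≡p))
... | inj₂ q≡σp = transposition-through σ-tr (sym q≡σp) p≢q

common-point-unique : IsTransposition σ → IsTransposition ρ → ¬ σ ≈ ρ →
  Moves σ p → Moves ρ p → Moves σ q → Moves ρ q → p ≡ q
common-point-unique {p = p} {q} σ-tr ρ-tr σ≉ρ σ⇝p ρ⇝p σ⇝q ρ⇝q with p ≟ q
... | yes p≡q = p≡q
... | no p≢q = ⊥-elim (σ≉ρ λ k → trans (transposition-determined σ-tr σ⇝p σ⇝q p≢q k)
                                       (sym (transposition-determined ρ-tr ρ⇝p ρ⇝q p≢q k)))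

partners-distinct : IsTransposition σ → IsTransposition ρ → ¬ σ ≈ ρ → Moves σ i → Moves ρ i →
  σ ⟨$⟩ʳ i ≢ ρ ⟨$⟩ʳ i
partners-distinct {σ = σ} {ρ} {i} σ-tr ρ-tr σ≉ρ σ⇝i ρ⇝i σi≡ρi = σ≉ρ λ k →
  trans (transposition-at σ-tr σ⇝i k)
        (trans (cong (λ z → swap i z k) σi≡ρi) (sym (transposition-at ρ-tr ρ⇝i k)))

Meet : Sym n → Sym n → Set
Meet σ ρ = ∃[ p ] (Moves σ p × Moves ρ p)

meet-or-disjoint : (σ-tr : IsTransposition σ) (ρ-tr : IsTransposition ρ) →
  Meet σ ρ ⊎ Distinct₄ (Tr.fst σ-tr) (Tr.snd σ-tr) (Tr.fst ρ-tr) (Tr.snd ρ-tr)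
meet-or-disjoint σ-tr@(transposition x y x≢y _) ρ-tr@(transposition z w z≢w _)
  with x ≟ z | x ≟ w | y ≟ z | y ≟ w
... | yes refl | _ | _ | _ = inj₁ (x , transposition-moves-fst σ-tr , transposition-moves-fst ρ-tr)
... | _ | yes refl | _ | _ = inj₁ (x , transposition-moves-fst σ-tr , transposition-moves-snd ρ-tr)
... | _ | _ | yes refl | _ = inj₁ (y , transposition-moves-snd σ-tr , transposition-moves-fst ρ-tr)
... | _ | _ | _ | yes refl = inj₁ (y , transposition-moves-snd σ-tr , transposition-moves-snd ρ-tr)
... | no x≢z | no x≢w | no y≢z | no y≢w = inj₂ (record
  { a≢b = x≢y ; a≢c = x≢z ; a≢d = x≢w ; b≢c = y≢z ; b≢d = y≢w ; c≢d = z≢w })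

swap-disjoint-comm : Distinct₄ a b c d → ∀ k → swap c d (swap a b k) ≡ swap a b (swap c d k)
swap-disjoint-comm D = swap-swap-at (swap-other a≢c a≢d) (swap-other b≢c b≢d)
  where open Distinct₄ D

swap-conjugate-adjacent : Distinct₃ i a c → ∀ k → swap i a (swap i c (swap i a k)) ≡ swap a c k
swap-conjugate-adjacent {i = i} {a} {c} D k = begin
  swap i a (swap i c (swap i a k)) ≡⟨ swap-swap-at (swap-fst i a) (swap-other (≢-sym a≢c) (≢-sym b≢c)) (swap i a k) ⟩
  swap a c (swap i a (swap i a k)) ≡⟨ cong (swap a c) (swap-involutive i a k) ⟩
  swap a c k                       ∎
  where open Distinct₃ D
        open ≡-Reasoning

swap-disjoint-fst : Distinct₄ a b c d → swap c d (swap a b a) ≡ b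
swap-disjoint-fst {a = a} {b} {c} {d} D = trans (cong (swap c d) (swap-fst a b)) (swap-other b≢c b≢d)
  where open Distinct₄ D

swap-adjacent-centre : Distinct₃ i a c → swap i c (swap i a i) ≡ a
swap-adjacent-centre {i = i} {a} {c} D = trans (cong (swap i c) (swap-fst i a)) (swap-other (≢-sym a≢b) b≢c)
  where open Distinct₃ D

swap-adjacent-leaf : (i a c : Fin n) → swap i c (swap i a a) ≡ c
swap-adjacent-leaf i a c = trans (cong (swap i c) (swap-snd i a)) (swap-fst i c)

-- Factorisations into two transpositions

module Factorisation (τ : Sym n) (u-tr : IsTransposition u) (v-tr : IsTransposition v)
                     (vu≈τ : v · u ≈ τ) where

  right-factor : ∀ k → u ⟨$⟩ʳ k ≡ v ⟨$⟩ʳ (τ ⟨$⟩ʳ k)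
  right-factor k = trans (sym (transposition-involutive v-tr (u ⟨$⟩ʳ k))) (cong (v ⟨$⟩ʳ_) (vu≈τ k))

  left-factor : ∀ k → v ⟨$⟩ʳ k ≡ τ ⟨$⟩ʳ (u ⟨$⟩ʳ k)
  left-factor k = trans (cong (v ⟨$⟩ʳ_) (sym (transposition-involutive u-tr k))) (vu≈τ (u ⟨$⟩ʳ k))

  -- If u moves a elsewhere than τ does, then v = (u a  τ a) fixes a, so τ (u a) = v (u (u a)) = v a = a.
  crossing : τ ⟨$⟩ʳ a ≡ b → b ≢ a → Moves u a → u ⟨$⟩ʳ a ≢ b → τ ⟨$⟩ʳ (u ⟨$⟩ʳ a) ≡ a
  crossing {a = a} refl τa≢a (moves ua≢a) ua≢τa = begin
    τ ⟨$⟩ʳ (u ⟨$⟩ʳ a)            ≡⟨ sym (vu≈τ (u ⟨$⟩ʳ a)) ⟩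
    v ⟨$⟩ʳ (u ⟨$⟩ʳ (u ⟨$⟩ʳ a))    ≡⟨ cong (v ⟨$⟩ʳ_) (transposition-involutive u-tr a) ⟩
    v ⟨$⟩ʳ a                      ≡⟨ transposition-through v-tr (vu≈τ a) ua≢τa a ⟩
    swap (u ⟨$⟩ʳ a) (τ ⟨$⟩ʳ a) a  ≡⟨ swap-other (≢-sym ua≢a) (≢-sym τa≢a) ⟩
    a                             ∎
    where open ≡-Reasoning

disjoint-factorisation : Distinct₄ a b c d → IsTransposition u → IsTransposition v →
  v · u ≈ transpose c d · transpose a b → u ≈ transpose a b ⊎ u ≈ transpose c d
disjoint-factorisation {a = a} {b} {c} {d} {u = u} {v} D u-tr v-tr vu≈τ = by-image-of-a (locate (u ⟨$⟩ʳ a) b a)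
  where
  open Factorisation (transpose c d · transpose a b) u-tr v-tr vu≈τ
  open Distinct₄ D
  open ≡-Reasoning

  by-image-of-a : Location (u ⟨$⟩ʳ a) b a → u ≈ transpose a b ⊎ u ≈ transpose c d
  by-image-of-a (at-fst ua≡b) = inj₁ (transposition-through u-tr ua≡b a≢b)
  by-image-of-a (at-snd ua≡a) = inj₂ λ k → begin
    u ⟨$⟩ʳ k                          ≡⟨ right-factor k ⟩
    v ⟨$⟩ʳ swap c d (swap a b k)      ≡⟨ v≈ab _ ⟩
    swap a b (swap c d (swap a b k))  ≡⟨ cong (swap a b) (swap-disjoint-comm D k) ⟩
    swap a b (swap a b (swap c d k))  ≡⟨ swap-involutive a b _ ⟩
    swap c d k                        ∎
    where
    v≈ab : v ≈ transpose a b
    v≈ab = transposition-through v-tr (trans (cong (v ⟨$⟩ʳ_) (sym ua≡a)) (trans (vu≈τ a) (swap-disjoint-fst D))) a≢b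
  by-image-of-a (elsewhere ua≢b ua≢a) = ⊥-elim (ua≢a (swap-≡-fixed τ[ua]≡a a≢c a≢d))
    where
    τ[ua]≡a : swap c d (u ⟨$⟩ʳ a) ≡ a
    τ[ua]≡a = trans (cong (swap c d) (sym (swap-other ua≢a ua≢b)))
                    (crossing (swap-disjoint-fst D) (≢-sym a≢b) (moves ua≢a) ua≢b)

adjacent-factorisation : Distinct₃ i a c → IsTransposition u → IsTransposition v →
  v · u ≈ transpose i c · transpose i a →
  u ≈ transpose i a ⊎ (u ≈ transpose a c × v ≈ transpose i a) ⊎ (u ≈ transpose i c × v ≈ transpose a c)
adjacent-factorisation {i = i} {a} {c} {u = u} {v} D u-tr v-tr vu≈τ =
  by-image-of-i (u ⟨$⟩ʳ i ≟ a) (locate (u ⟨$⟩ʳ i) i c)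
  where
  open Factorisation (transpose i c · transpose i a) u-tr v-tr vu≈τ
  open Distinct₃ D renaming (a≢b to i≢a; a≢c to i≢c; b≢c to a≢c)
  open ≡-Reasoning

  by-image-of-i : Dec (u ⟨$⟩ʳ i ≡ a) → Location (u ⟨$⟩ʳ i) i c →
    u ≈ transpose i a ⊎ (u ≈ transpose a c × v ≈ transpose i a) ⊎ (u ≈ transpose i c × v ≈ transpose a c)
  by-image-of-i (yes ui≡a) _ = inj₁ (transposition-through u-tr ui≡a i≢a)
  by-image-of-i (no _) (at-fst ui≡i) = inj₂ (inj₁ (u≈ac , v≈ia))
    where
    v≈ia : v ≈ transpose i a
    v≈ia = transposition-through v-tr
             (trans (cong (v ⟨$⟩ʳ_) (sym ui≡i)) (trans (vu≈τ i) (swap-adjacent-centre D))) i≢a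
    u≈ac : u ≈ transpose a c
    u≈ac k = begin
      u ⟨$⟩ʳ k                          ≡⟨ right-factor k ⟩
      v ⟨$⟩ʳ swap i c (swap i a k)      ≡⟨ v≈ia _ ⟩
      swap i a (swap i c (swap i a k))  ≡⟨ swap-conjugate-adjacent D k ⟩
      swap a c k                        ∎
  by-image-of-i (no _) (at-snd ui≡c) = inj₂ (inj₂ (u≈ic , v≈ac))
    where
    u≈ic : u ≈ transpose i c
    u≈ic = transposition-through u-tr ui≡c i≢c
    D′ : Distinct₃ i c a
    D′ = record { a≢b = i≢c ; a≢c = i≢a ; b≢c = ≢-sym a≢c }
    v≈ac : v ≈ transpose a c
    v≈ac k = begin
      v ⟨$⟩ʳ k                          ≡⟨ left-factor k ⟩
      swap i c (swap i a (u ⟨$⟩ʳ k))    ≡⟨ cong (swap i c ∘ swap i a) (u≈ic k) ⟩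
      swap i c (swap i a (swap i c k))  ≡⟨ swap-conjugate-adjacent D′ k ⟩
      swap c a k                        ≡⟨ swap-comm c a k ⟩
      swap a c k                        ∎
  by-image-of-i (no ui≢a) (elsewhere ui≢i ui≢c) =
    ⊥-elim (ui≢i (trans (sym τ[ui]≡ui) (crossing (swap-adjacent-centre D) (≢-sym i≢a) (moves ui≢i) ui≢a)))
    where
    τ[ui]≡ui : swap i c (swap i a (u ⟨$⟩ʳ i)) ≡ u ⟨$⟩ʳ i
    τ[ui]≡ui = trans (cong (swap i c) (swap-other ui≢i ui≢a)) (swap-other ui≢i ui≢c)

conjugate : Sym n → Sym n → Sym n
conjugate π σ = π · σ · flip π

conjugate-hom : (π σ ρ : Sym n) → conjugate π (σ · ρ) ≈ conjugate π σ · conjugate π ρ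
conjugate-hom π σ ρ k = cong (λ z → π ⟨$⟩ʳ (σ ⟨$⟩ʳ z)) (sym (inverseˡ π))

conjugation : Sym n → VertexPerm n
conjugation π = record
  { to = conjugate π
  ; from = conjugate (flip π)
  ; to-cong = λ σ≈ρ k → cong (π ⟨$⟩ʳ_) (σ≈ρ _)
  ; from-cong = λ σ≈ρ k → cong (π ⟨$⟩ˡ_) (σ≈ρ _)
  ; to-from = λ σ k → trans (inverseʳ π) (cong (σ ⟨$⟩ʳ_) (inverseʳ π))
  ; from-to = λ σ k → trans (inverseˡ π) (cong (σ ⟨$⟩ʳ_) (inverseˡ π))
  }

common-neighbour-factorisation : (x : Sym n) → IsTransposition σ → IsTransposition v →
  x ≈ u · σ → x ≈ v · τ → v · u ≈ τ · σ
common-neighbour-factorisation {σ = s} {v = v} {u = u} {τ = t} x s-tr v-tr x≈us x≈vt k = begin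
  v ⟨$⟩ʳ (u ⟨$⟩ʳ k)                  ≡⟨ cong (λ z → v ⟨$⟩ʳ (u ⟨$⟩ʳ z)) (sym (transposition-involutive s-tr k)) ⟩
  v ⟨$⟩ʳ (u ⟨$⟩ʳ (s ⟨$⟩ʳ (s ⟨$⟩ʳ k)))  ≡⟨ cong (v ⟨$⟩ʳ_) (sym (x≈us (s ⟨$⟩ʳ k))) ⟩
  v ⟨$⟩ʳ (x ⟨$⟩ʳ (s ⟨$⟩ʳ k))           ≡⟨ cong (v ⟨$⟩ʳ_) (x≈vt (s ⟨$⟩ʳ k)) ⟩
  v ⟨$⟩ʳ (v ⟨$⟩ʳ (t ⟨$⟩ʳ (s ⟨$⟩ʳ k)))  ≡⟨ transposition-involutive v-tr _ ⟩
  t ⟨$⟩ʳ (s ⟨$⟩ʳ k)                  ∎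
  where open ≡-Reasoning

neighbour-through-itself : (x : Sym n) → IsTransposition σ → x ≈ u · σ → u ≈ σ → x ≈ id
neighbour-through-itself {σ = s} x s-tr x≈us u≈s k =
  trans (x≈us k) (trans (u≈s _) (transposition-involutive s-tr k))

module CayleyGraph (T : TranspositionSet n) (isT : IsTranspositionSet T) where

  generator-transposition : (σ : Sym n) → σ ∈S T → IsTransposition σ
  generator-transposition σ (x , y , xy∈T , σ≈xy) = transposition x y (isT xy∈T) σ≈xy

  ∈S-≈ : (σ ρ : Sym n) → σ ≈ ρ → σ ∈S T → ρ ∈S T
  ∈S-≈ σ ρ σ≈ρ (x , y , xy∈T , σ≈xy) = x , y , xy∈T , λ k → trans (sym (σ≈ρ k)) (σ≈xy k)

  generator-at : σ ∈S T → Moves σ i → transpose i (σ ⟨$⟩ʳ i) ∈S T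
  generator-at {σ = σ} {i} σ∈S σ⇝i =
    ∈S-≈ σ (transpose i (σ ⟨$⟩ʳ i)) (transposition-at (generator-transposition σ σ∈S) σ⇝i) σ∈S

  Adj-≈ : (x x′ y y′ : Sym n) → x ≈ x′ → y ≈ y′ → Adj T x y → Adj T x′ y′
  Adj-≈ x x′ y y′ x≈x′ y≈y′ (s , s∈S , y≈sx) =
    s , s∈S , λ k → trans (sym (y≈y′ k)) (trans (y≈sx k) (cong (s ⟨$⟩ʳ_) (x≈x′ k)))

  id-adjacent : (σ : Sym n) → σ ∈S T → Adj T id σ
  id-adjacent σ σ∈S = σ , σ∈S , λ _ → refl

  adjacent-to-id : (σ : Sym n) → Adj T id σ → σ ∈S T
  adjacent-to-id σ (s , s∈S , σ≈s) = ∈S-≈ s σ (λ k → sym (σ≈s k)) s∈S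

  module _ (α : GroupAutS T) where
    private A = gperm α

    groupAut-id : gautMap α id ≈ id
    groupAut-id k = begin
      z ⟨$⟩ʳ k                      ≡⟨ sym (inverseˡ z) ⟩
      z ⟨$⟩ˡ (z ⟨$⟩ʳ (z ⟨$⟩ʳ k))      ≡⟨ cong (z ⟨$⟩ˡ_) (sym (idempotent k)) ⟩
      z ⟨$⟩ˡ (z ⟨$⟩ʳ k)               ≡⟨ inverseˡ z ⟩
      k                              ∎
      where
      open ≡-Reasoning
      z = gautMap α id
      idempotent : ∀ k → z ⟨$⟩ʳ k ≡ z ⟨$⟩ʳ (z ⟨$⟩ʳ k)
      idempotent k = trans (to-cong A {id} {id · id} (λ _ → refl) k) (hom α id id k)

    groupAut-inverse-hom : ∀ x y → from A (x · y) ≈ from A x · from A y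
    groupAut-inverse-hom x y k =
      trans (from-cong A {x · y} {to A (x′ · y′)} x·y≈ k) (from-to A (x′ · y′) k)
      where
      x′ = from A x
      y′ = from A y
      x·y≈ : x · y ≈ to A (x′ · y′)
      x·y≈ k = sym (trans (hom α x′ y′ k) (trans (cong (to A x′ ⟨$⟩ʳ_) (to-from A y k)) (to-from A x _)))

    groupAut-inverse-maps-S : (s : Sym n) → s ∈S T → from A s ∈S T
    groupAut-inverse-maps-S s s∈S with onto-S α s s∈S
    ... | t , t∈S , αt≈s =
      ∈S-≈ t (from A s) (λ k → trans (sym (from-to A t k)) (from-cong A {to A t} {s} αt≈s k)) t∈S

  homomorphism-adjacency : (F : VertexPerm n) → (∀ x y → to F (x · y) ≈ to F x · to F y) →
    (∀ s → s ∈S T → to F s ∈S T) → ∀ x y → Adj T x y → Adj T (to F x) (to F y)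
  homomorphism-adjacency F F-hom F-maps-S x y (s , s∈S , y≈sx) =
    to F s , F-maps-S s s∈S , λ k → trans (to-cong F {y} {s · x} y≈sx k) (F-hom s x k)

  groupAut⇒stabAut : GroupAutS T → StabAut T
  groupAut⇒stabAut α = record
    { aut = record
      { perm = A
      ; to-adj = λ {x} {y} → homomorphism-adjacency A (hom α) (maps-S α) x y
      ; from-adj = λ {x} {y} → homomorphism-adjacency A⁻¹ (groupAut-inverse-hom α) (groupAut-inverse-maps-S α) x y
      }
    ; fix-e = groupAut-id α
    }
    where
    A = gperm α
    A⁻¹ : VertexPerm n
    A⁻¹ = record { to = from A ; from = to A ; to-cong = from-cong A ; from-cong = to-cong A
                 ; to-from = from-to A ; from-to = to-from A }

  inverse : StabAut T → StabAut T
  inverse f = record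
    { aut = record
      { perm = record { to = from F ; from = to F ; to-cong = from-cong F ; from-cong = to-cong F
                      ; to-from = from-to F ; from-to = to-from F }
      ; to-adj = from-adj (aut f)
      ; from-adj = to-adj (aut f)
      }
    ; fix-e = λ k → trans (from-cong F {id} {to F id} (λ z → sym (fix-e f z)) k) (from-to F id k)
    }
    where F = perm (aut f)

  _∘ˢ_ : StabAut T → StabAut T → StabAut T
  f ∘ˢ g = record
    { aut = record
      { perm = record
        { to = to F ∘ to G
        ; from = from G ∘ from F
        ; to-cong = to-cong F ∘ to-cong G
        ; from-cong = from-cong G ∘ from-cong F
        ; to-from = λ x k → trans (to-cong F (to-from G (from F x)) k) (to-from F x k)
        ; from-to = λ x k → trans (from-cong G (from-to F (to G x)) k) (from-to G x k)
        }
      ; to-adj = to-adj (aut f) ∘ to-adj (aut g)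
      ; from-adj = from-adj (aut g) ∘ from-adj (aut f)
      }
    ; fix-e = λ k → trans (to-cong F (fix-e g) k) (fix-e f k)
    }
    where
    F = perm (aut f)
    G = perm (aut g)

  module _ (f : StabAut T) where
    private F = perm (aut f)

    stab-maps-S : (s : Sym n) → s ∈S T → stabMap f s ∈S T
    stab-maps-S s s∈S = adjacent-to-id (stabMap f s)
      (Adj-≈ (stabMap f id) id (stabMap f s) (stabMap f s) (fix-e f) (λ _ → refl)
        (to-adj (aut f) (id-adjacent s s∈S)))

    stab-injective : (σ ρ : Sym n) → stabMap f σ ≈ stabMap f ρ → σ ≈ ρ
    stab-injective σ ρ fσ≈fρ k = trans (sym (from-to F σ k)) (trans (from-cong F fσ≈fρ k) (from-to F ρ k))

    image-transposition : (s : Sym n) → s ∈S T → IsTransposition (stabMap f s)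
    image-transposition s s∈S = generator-transposition (stabMap f s) (stab-maps-S s s∈S)

    image-≉ : (σ ρ : Sym n) → ¬ σ ≈ ρ → ¬ stabMap f σ ≈ stabMap f ρ
    image-≉ σ ρ σ≉ρ = σ≉ρ ∘ stab-injective σ ρ

    stab-nontrivial : (σ : Sym n) → ¬ σ ≈ id → ¬ stabMap f σ ≈ id
    stab-nontrivial σ σ≉id fσ≈id = σ≉id (stab-injective σ id λ k → trans (fσ≈id k) (sym (fix-e f k)))

  local-normal : (f : StabAut T) (l : LocalAut T) →
    (stabMap f (localMap l (stabInv f id)) ≈ id) × (∀ s → s ∈S T → stabMap f (localMap l (stabInv f s)) ≈ s)
  local-normal f l = fixes-e , fixes-S
    where
    F = perm (aut f)
    L = perm (aut (stab l))
    fixes-e : stabMap f (localMap l (stabInv f id)) ≈ id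
    fixes-e k = trans (to-cong F {localMap l (stabInv f id)} {id}
                         (λ z → trans (to-cong L {stabInv f id} {id} (fix-e (inverse f)) z) (fix-e (stab l) z)) k)
                      (fix-e f k)
    fixes-S : ∀ s → s ∈S T → stabMap f (localMap l (stabInv f s)) ≈ s
    fixes-S s s∈S k = trans (to-cong F {localMap l (stabInv f s)} {stabInv f s}
                               (fix-S l (stabInv f s) (stab-maps-S (inverse f) s s∈S)) k)
                            (to-from F s k)

  groupAut-fixing-S-is-trivial : Generates T → (α : GroupAutS T) → (∀ s → s ∈S T → gautMap α s ≈ s) →
    ∀ σ → gautMap α σ ≈ σ
  groupAut-fixing-S-is-trivial generates α fixes-S σ k with generates σ
  ... | w , w⊆T , σ≈w = trans (to-cong A {σ} {wordProd w} σ≈w k) (trans (on-word w w⊆T k) (sym (σ≈w k)))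
    where
    A = gperm α
    on-word : ∀ w → (∀ {p} → p ∈ w → p ∈ T) → to A (wordProd w) ≈ wordProd w
    on-word [] _ = groupAut-id α
    on-word ((x , y) ∷ w) w⊆T k =
      trans (hom α (transpose x y) (wordProd w) k)
            (trans (cong (to A (transpose x y) ⟨$⟩ʳ_) (on-word w (w⊆T ∘ there) k))
                   (fixes-S (transpose x y) (x , y , w⊆T (here refl) , λ _ → refl) _))

  local∩groupAut-trivial : Generates T → (l : LocalAut T) (α : GroupAutS T) →
    (∀ σ → localMap l σ ≈ gautMap α σ) → ∀ σ → localMap l σ ≈ σ
  local∩groupAut-trivial generates l α l≈α σ k =
    trans (l≈α σ k) (groupAut-fixing-S-is-trivial generates α α-fixes-S σ k)
    where
    α-fixes-S : ∀ s → s ∈S T → gautMap α s ≈ s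
    α-fixes-S s s∈S z = trans (sym (l≈α s z)) (fix-S l s s∈S z)

  record UniqueCommonNeighbour (s t : Sym n) : Set where
    field
      vertex     : Sym n
      nontrivial : ¬ vertex ≈ id
      adjacent₁  : Adj T s vertex
      adjacent₂  : Adj T t vertex
      unique     : ∀ y → ¬ y ≈ id → Adj T s y → Adj T t y → y ≈ vertex

  record CommonNeighbour₃ (s t r : Sym n) : Set where
    field
      vertex     : Sym n
      nontrivial : ¬ vertex ≈ id
      adjacent₁  : Adj T s vertex
      adjacent₂  : Adj T t vertex
      adjacent₃  : Adj T r vertex

  module _ {s s′ t t′ : Sym n} (s≈s′ : s ≈ s′) (t≈t′ : t ≈ t′) where

    uniqueCommonNeighbour-≈ : UniqueCommonNeighbour s t → UniqueCommonNeighbour s′ t′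
    uniqueCommonNeighbour-≈ N = record
      { vertex = vertex ; nontrivial = nontrivial
      ; adjacent₁ = Adj-≈ s s′ vertex vertex s≈s′ (λ _ → refl) adjacent₁
      ; adjacent₂ = Adj-≈ t t′ vertex vertex t≈t′ (λ _ → refl) adjacent₂
      ; unique = λ y y≉id s′y t′y → unique y y≉id (Adj-≈ s′ s y y (λ k → sym (s≈s′ k)) (λ _ → refl) s′y)
                                                   (Adj-≈ t′ t y y (λ k → sym (t≈t′ k)) (λ _ → refl) t′y)
      }
      where open UniqueCommonNeighbour N

    commonNeighbour₃-≈ : {r r′ : Sym n} → r ≈ r′ → CommonNeighbour₃ s t r → CommonNeighbour₃ s′ t′ r′
    commonNeighbour₃-≈ {r} {r′} r≈r′ N = record
      { vertex = vertex ; nontrivial = nontrivial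
      ; adjacent₁ = Adj-≈ s s′ vertex vertex s≈s′ (λ _ → refl) adjacent₁
      ; adjacent₂ = Adj-≈ t t′ vertex vertex t≈t′ (λ _ → refl) adjacent₂
      ; adjacent₃ = Adj-≈ r r′ vertex vertex r≈r′ (λ _ → refl) adjacent₃
      }
      where open CommonNeighbour₃ N

  uniqueCommonNeighbour-image : (f : StabAut T) → UniqueCommonNeighbour s t →
    UniqueCommonNeighbour (stabMap f s) (stabMap f t)
  uniqueCommonNeighbour-image {s = s} {t} f N = record
    { vertex = stabMap f vertex
    ; nontrivial = stab-nontrivial f vertex nontrivial
    ; adjacent₁ = to-adj (aut f) adjacent₁
    ; adjacent₂ = to-adj (aut f) adjacent₂
    ; unique = λ y y≉id fs-y ft-y →
        let y′ = from F y
            y′≈vertex = unique y′ (stab-nontrivial (inverse f) y y≉id)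
                     (Adj-≈ (from F (to F s)) s y′ y′ (from-to F s) (λ _ → refl) (from-adj (aut f) fs-y))
                     (Adj-≈ (from F (to F t)) t y′ y′ (from-to F t) (λ _ → refl) (from-adj (aut f) ft-y))
        in λ k → trans (sym (to-from F y k)) (to-cong F y′≈vertex k)
    }
    where
    open UniqueCommonNeighbour N
    F = perm (aut f)

  commonNeighbour₃-image : (f : StabAut T) → CommonNeighbour₃ s t r →
    CommonNeighbour₃ (stabMap f s) (stabMap f t) (stabMap f r)
  commonNeighbour₃-image f N = record
    { vertex = stabMap f vertex
    ; nontrivial = stab-nontrivial f vertex nontrivial
    ; adjacent₁ = to-adj (aut f) adjacent₁
    ; adjacent₂ = to-adj (aut f) adjacent₂
    ; adjacent₃ = to-adj (aut f) adjacent₃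
    }
    where open CommonNeighbour₃ N

  uniqueCommonNeighbour-preimage : (f : StabAut T) → UniqueCommonNeighbour (stabMap f s) (stabMap f t) →
    UniqueCommonNeighbour s t
  uniqueCommonNeighbour-preimage {s = s} {t} f N =
    uniqueCommonNeighbour-≈ (from-to F s) (from-to F t) (uniqueCommonNeighbour-image (inverse f) N)
    where F = perm (aut f)

  commonNeighbour₃-preimage : (f : StabAut T) → CommonNeighbour₃ (stabMap f s) (stabMap f t) (stabMap f r) →
    CommonNeighbour₃ s t r
  commonNeighbour₃-preimage {s = s} {t} {r} f N =
    commonNeighbour₃-≈ (from-to F s) (from-to F t) (from-to F r) (commonNeighbour₃-image (inverse f) N)
    where F = perm (aut f)

  disjoint-uniqueCommonNeighbour : Distinct₄ a b c d → transpose a b ∈S T → transpose c d ∈S T →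
    UniqueCommonNeighbour (transpose a b) (transpose c d)
  disjoint-uniqueCommonNeighbour {a = a} {b} {c} {d} D ab∈S cd∈S = record
    { vertex = cd · ab
    ; nontrivial = λ x≈id → a≢b (trans (sym (x≈id a)) (swap-disjoint-fst D))
    ; adjacent₁ = cd , cd∈S , λ _ → refl
    ; adjacent₂ = ab , ab∈S , swap-disjoint-comm D
    ; unique = unique
    }
    where
    open Distinct₄ D
    ab = transpose a b
    cd = transpose c d

    unique : ∀ y → ¬ y ≈ id → Adj T ab y → Adj T cd y → y ≈ cd · ab
    unique y y≉id (u , u∈S , y≈u·ab) (v , v∈S , y≈v·cd)
      with disjoint-factorisation D (generator-transposition u u∈S) v-tr
             (common-neighbour-factorisation {u = u} {τ = cd} y (transpose-isTransposition a≢b) v-tr y≈u·ab y≈v·cd)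
      where v-tr = generator-transposition v v∈S
    ... | inj₁ u≈ab = ⊥-elim (y≉id (neighbour-through-itself {u = u} y (transpose-isTransposition a≢b) y≈u·ab u≈ab))
    ... | inj₂ u≈cd = λ k → trans (y≈u·ab k) (u≈cd _)

  -- Both further factorisations of (i c)(i a) produce a second common neighbour, with a different image of a.
  adjacent-¬uniqueCommonNeighbour : Distinct₃ i a c → transpose i a ∈S T → transpose i c ∈S T →
    ¬ UniqueCommonNeighbour (transpose i a) (transpose i c)
  adjacent-¬uniqueCommonNeighbour {i = i} {a} {c} D ia∈S ic∈S
    record { vertex = x ; nontrivial = x≉id ; adjacent₁ = u , u∈S , x≈u·ia ; adjacent₂ = v , v∈S , x≈v·ic
           ; unique = unique } =
    by-factorisation (adjacent-factorisation D (generator-transposition u u∈S) v-tr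
                        (common-neighbour-factorisation {u = u} {τ = ic} x ia-tr v-tr x≈u·ia x≈v·ic))
    where
    open Distinct₃ D renaming (a≢b to i≢a; a≢c to i≢c; b≢c to a≢c)
    open ≡-Reasoning
    ia = transpose i a
    ic = transpose i c
    ia-tr = transpose-isTransposition i≢a
    v-tr = generator-transposition v v∈S

    x-at-a : x ⟨$⟩ʳ a ≡ u ⟨$⟩ʳ i
    x-at-a = trans (x≈u·ia a) (cong (u ⟨$⟩ʳ_) (swap-snd i a))

    by-factorisation : u ≈ transpose i a ⊎ (u ≈ transpose a c × v ≈ transpose i a) ⊎
                       (u ≈ transpose i c × v ≈ transpose a c) → ⊥
    by-factorisation (inj₁ u≈ia) = x≉id (neighbour-through-itself {u = u} x ia-tr x≈u·ia u≈ia)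
    by-factorisation (inj₂ (inj₁ (u≈ac , _))) = i≢c (begin
      i                 ≡⟨ sym (swap-other i≢a i≢c) ⟩
      swap a c i        ≡⟨ sym (u≈ac i) ⟩
      u ⟨$⟩ʳ i          ≡⟨ sym x-at-a ⟩
      x ⟨$⟩ʳ a          ≡⟨ sym (y≈x a) ⟩
      (ic · ia) ⟨$⟩ʳ a  ≡⟨ swap-adjacent-leaf i a c ⟩
      c                 ∎)
      where
      y≈x : ic · ia ≈ x
      y≈x = unique (ic · ia) (λ y≈id → a≢c (trans (sym (y≈id a)) (swap-adjacent-leaf i a c)))
              (ic , ic∈S , λ _ → refl)
              (u , u∈S , λ k → trans (swap-swap-at (swap-fst i c) (swap-other (≢-sym i≢a) a≢c) k)
                                     (trans (swap-comm c a (swap i c k)) (sym (u≈ac _))))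
    by-factorisation (inj₂ (inj₂ (u≈ic , v≈ac))) = i≢c (begin
      i                 ≡⟨ sym (swap-other i≢a i≢c) ⟩
      swap a c i        ≡⟨ sym (v≈ac i) ⟩
      v ⟨$⟩ʳ i          ≡⟨ cong (v ⟨$⟩ʳ_) (sym (swap-snd i a)) ⟩
      (v · ia) ⟨$⟩ʳ a   ≡⟨ y≈x a ⟩
      x ⟨$⟩ʳ a          ≡⟨ x-at-a ⟩
      u ⟨$⟩ʳ i          ≡⟨ u≈ic i ⟩
      swap i c i        ≡⟨ swap-fst i c ⟩
      c                 ∎)
      where
      y≈x : v · ia ≈ x
      y≈x = unique (v · ia) (λ y≈id → i≢a (trans (sym (swap-other i≢a i≢c)) (trans (sym (v≈ac i))
                                          (trans (cong (v ⟨$⟩ʳ_) (sym (swap-snd i a))) (y≈id a)))))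
              (v , v∈S , λ _ → refl)
              (ia , ia∈S , λ k → trans (v≈ac _)
                                       (sym (swap-swap-at (swap-fst i a) (swap-other (≢-sym i≢c) (≢-sym a≢c)) k)))

  triangle-commonNeighbour₃ : Distinct₃ i a c → transpose i a ∈S T → transpose i c ∈S T → transpose a c ∈S T →
    CommonNeighbour₃ (transpose i a) (transpose i c) (transpose a c)
  triangle-commonNeighbour₃ {i = i} {a} {c} D ia∈S ic∈S ac∈S = record
    { vertex = transpose i c · transpose i a
    ; nontrivial = λ x≈id → a≢c (trans (sym (x≈id a)) (swap-adjacent-leaf i a c))
    ; adjacent₁ = transpose i c , ic∈S , λ _ → refl
    ; adjacent₂ = transpose a c , ac∈S , λ k →
        trans (swap-swap-at (swap-fst i c) (swap-other (≢-sym i≢a) a≢c) k) (swap-comm c a (swap i c k))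
    ; adjacent₃ = transpose i a , ia∈S , λ k →
        sym (swap-swap-at (swap-snd i a) (swap-other (≢-sym i≢c) (≢-sym a≢c)) k)
    }
    where open Distinct₃ D renaming (a≢b to i≢a; a≢c to i≢c; b≢c to a≢c)

  -- Writing the common neighbour as u · (i a), factorising against (i b) makes u move b,
  -- factorising against (i c) makes u fix b.
  star-¬commonNeighbour₃ : Distinct₄ i a b c → ¬ CommonNeighbour₃ (transpose i a) (transpose i b) (transpose i c)
  star-¬commonNeighbour₃ {i = i} {a} {b} {c} D
    record { vertex = x ; nontrivial = x≉id ; adjacent₁ = u , u∈S , x≈u·ia
           ; adjacent₂ = v , v∈S , x≈v·ib ; adjacent₃ = w , w∈S , x≈w·ic } =
    fixes-b (factors w w∈S x≈w·ic (record { a≢b = i≢a ; a≢c = i≢c ; b≢c = a≢c }))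
            (moves-b (factors v v∈S x≈v·ib (record { a≢b = i≢a ; a≢c = i≢b ; b≢c = a≢b })))
    where
    open Distinct₄ D renaming (a≢b to i≢a; a≢c to i≢b; a≢d to i≢c; b≢c to a≢b; b≢d to a≢c; c≢d to b≢c)
    ia-tr = transpose-isTransposition i≢a
    u-tr = generator-transposition u u∈S

    factors : {d : Fin n} (v′ : Sym n) → v′ ∈S T → x ≈ v′ · transpose i d → Distinct₃ i a d →
      u ≈ transpose i a ⊎ (u ≈ transpose a d × v′ ≈ transpose i a) ⊎ (u ≈ transpose i d × v′ ≈ transpose a d)
    factors {d} v′ v′∈S x≈v′·id D₃ =
      adjacent-factorisation D₃ u-tr v′-tr
        (common-neighbour-factorisation {u = u} {τ = transpose i d} x ia-tr v′-tr x≈u·ia x≈v′·id)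
      where v′-tr = generator-transposition v′ v′∈S

    moves-b : u ≈ transpose i a ⊎ (u ≈ transpose a b × v ≈ transpose i a) ⊎ (u ≈ transpose i b × v ≈ transpose a b) →
      Moves u b
    moves-b (inj₁ u≈ia) = ⊥-elim (x≉id (neighbour-through-itself {u = u} x ia-tr x≈u·ia u≈ia))
    moves-b (inj₂ (inj₁ (u≈ab , _))) = moves-≈ {ρ = u} (λ k → sym (u≈ab k)) (transpose-moves-snd a≢b)
    moves-b (inj₂ (inj₂ (u≈ib , _))) = moves-≈ {ρ = u} (λ k → sym (u≈ib k)) (transpose-moves-snd i≢b)

    fixes-b : u ≈ transpose i a ⊎ (u ≈ transpose a c × w ≈ transpose i a) ⊎ (u ≈ transpose i c × w ≈ transpose a c) →
      ¬ Moves u b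
    fixes-b (inj₁ u≈ia) _ = x≉id (neighbour-through-itself {u = u} x ia-tr x≈u·ia u≈ia)
    fixes-b (inj₂ (inj₁ (u≈ac , _))) (moves ub≢b) = ub≢b (trans (u≈ac b) (swap-other (≢-sym a≢b) b≢c))
    fixes-b (inj₂ (inj₂ (u≈ic , _))) (moves ub≢b) = ub≢b (trans (u≈ic b) (swap-other (≢-sym i≢b) b≢c))

  generators-meet-or-uniqueCommonNeighbour : (s t : Sym n) → s ∈S T → t ∈S T →
    Meet s t ⊎ UniqueCommonNeighbour s t
  generators-meet-or-uniqueCommonNeighbour s t s∈S@(a , b , ab∈T , s≈ab) t∈S@(c , d , cd∈T , t≈cd)
    with meet-or-disjoint (generator-transposition s s∈S) (generator-transposition t t∈S)
  ... | inj₁ meet = inj₁ meet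
  ... | inj₂ D = inj₂ (uniqueCommonNeighbour-≈ (λ k → sym (s≈ab k)) (λ k → sym (t≈cd k))
                        (disjoint-uniqueCommonNeighbour D (a , b , ab∈T , λ _ → refl) (c , d , cd∈T , λ _ → refl)))

  meeting-¬uniqueCommonNeighbour : s ∈S T → t ∈S T → ¬ s ≈ t → Moves s i → Moves t i →
    ¬ UniqueCommonNeighbour s t
  meeting-¬uniqueCommonNeighbour {s = s} {t} {i} s∈S t∈S s≉t s⇝i t⇝i N =
    adjacent-¬uniqueCommonNeighbour D (generator-at s∈S s⇝i) (generator-at t∈S t⇝i) (uniqueCommonNeighbour-≈ s≈ t≈ N)
    where
    s-tr = generator-transposition s s∈S
    t-tr = generator-transposition t t∈S
    s≈ = transposition-at s-tr s⇝i
    t≈ = transposition-at t-tr t⇝i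
    D : Distinct₃ i (s ⟨$⟩ʳ i) (t ⟨$⟩ʳ i)
    D = record { a≢b = ≢-sym (moved s⇝i) ; a≢c = ≢-sym (moved t⇝i) ; b≢c = partners-distinct s-tr t-tr s≉t s⇝i t⇝i }

  meeting₃-¬commonNeighbour₃ : s ∈S T → t ∈S T → r ∈S T → ¬ s ≈ t → ¬ s ≈ r → ¬ t ≈ r →
    Moves s i → Moves t i → Moves r i → ¬ CommonNeighbour₃ s t r
  meeting₃-¬commonNeighbour₃ {s = s} {t} {r} {i} s∈S t∈S r∈S s≉t s≉r t≉r s⇝i t⇝i r⇝i N =
    star-¬commonNeighbour₃ D (commonNeighbour₃-≈ s≈ t≈ r≈ N)
    where
    s-tr = generator-transposition s s∈S
    t-tr = generator-transposition t t∈S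
    r-tr = generator-transposition r r∈S
    s≈ = transposition-at s-tr s⇝i
    t≈ = transposition-at t-tr t⇝i
    r≈ = transposition-at r-tr r⇝i
    D : Distinct₄ i (s ⟨$⟩ʳ i) (t ⟨$⟩ʳ i) (r ⟨$⟩ʳ i)
    D = record
      { a≢b = ≢-sym (moved s⇝i) ; a≢c = ≢-sym (moved t⇝i) ; a≢d = ≢-sym (moved r⇝i)
      ; b≢c = partners-distinct s-tr t-tr s≉t s⇝i t⇝i
      ; b≢d = partners-distinct s-tr r-tr s≉r s⇝i r⇝i
      ; c≢d = partners-distinct t-tr r-tr t≉r t⇝i r⇝i
      }

  module _ (f : StabAut T) where

    image-meet : s ∈S T → t ∈S T → ¬ s ≈ t → Moves s i → Moves t i → Meet (stabMap f s) (stabMap f t)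
    image-meet {s = s} {t} s∈S t∈S s≉t s⇝i t⇝i
      with generators-meet-or-uniqueCommonNeighbour (stabMap f s) (stabMap f t)
             (stab-maps-S f s s∈S) (stab-maps-S f t t∈S)
    ... | inj₁ meet = meet
    ... | inj₂ N = ⊥-elim (meeting-¬uniqueCommonNeighbour s∈S t∈S s≉t s⇝i t⇝i (uniqueCommonNeighbour-preimage f N))

    -- If the images of a star s , t , r did not share a point, they would form a triangle.
    image-star : s ∈S T → t ∈S T → r ∈S T → ¬ s ≈ t → ¬ s ≈ r → ¬ t ≈ r →
      Moves s i → Moves t i → Moves r i →
      ∃[ p ] (Moves (stabMap f s) p × Moves (stabMap f t) p × Moves (stabMap f r) p)
    image-star {s = s} {t} {r} s∈S t∈S r∈S s≉t s≉r t≉r s⇝i t⇝i r⇝i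
      with image-meet s∈S t∈S s≉t s⇝i t⇝i
    ... | p , fs⇝p , ft⇝p with moves? (stabMap f r) p
    ...   | yes fr⇝p = p , fs⇝p , ft⇝p , fr⇝p
    ...   | no fr↛p = ⊥-elim (meeting₃-¬commonNeighbour₃ s∈S t∈S r∈S s≉t s≉r t≉r s⇝i t⇝i r⇝i
                               (commonNeighbour₃-preimage f (commonNeighbour₃-≈ (λ k → sym (fs≈ k)) (λ k → sym (ft≈ k))
                                                               (λ k → sym (fr≈ k)) triangle)))
      where
      fs∈S = stab-maps-S f s s∈S
      ft∈S = stab-maps-S f t t∈S
      fr∈S = stab-maps-S f r r∈S
      fs-tr = generator-transposition (stabMap f s) fs∈S
      ft-tr = generator-transposition (stabMap f t) ft∈S
      fr-tr = generator-transposition (stabMap f r) fr∈S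
      sr = image-meet s∈S r∈S s≉r s⇝i r⇝i
      tr = image-meet t∈S r∈S t≉r t⇝i r⇝i
      p₂ = proj₁ sr
      p₃ = proj₁ tr
      p≢p₂ : p ≢ p₂
      p≢p₂ refl = fr↛p (proj₂ (proj₂ sr))
      p≢p₃ : p ≢ p₃
      p≢p₃ refl = fr↛p (proj₂ (proj₂ tr))
      fs≈ : stabMap f s ≈ transpose p p₂
      fs≈ = transposition-determined fs-tr fs⇝p (proj₁ (proj₂ sr)) p≢p₂
      ft≈ : stabMap f t ≈ transpose p p₃
      ft≈ = transposition-determined ft-tr ft⇝p (proj₁ (proj₂ tr)) p≢p₃
      p₂≢p₃ : p₂ ≢ p₃
      p₂≢p₃ p₂≡p₃ = s≉t (stab-injective f s t λ k →
        trans (fs≈ k) (trans (cong (λ z → swap p z k) p₂≡p₃) (sym (ft≈ k))))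
      fr≈ : stabMap f r ≈ transpose p₂ p₃
      fr≈ = transposition-determined fr-tr (proj₂ (proj₂ sr)) (proj₂ (proj₂ tr)) p₂≢p₃
      triangle : CommonNeighbour₃ (transpose p p₂) (transpose p p₃) (transpose p₂ p₃)
      triangle = triangle-commonNeighbour₃ (record { a≢b = p≢p₂ ; a≢c = p≢p₃ ; b≢c = p₂≢p₃ })
        (∈S-≈ (stabMap f s) (transpose p p₂) fs≈ fs∈S) (∈S-≈ (stabMap f t) (transpose p p₃) ft≈ ft∈S)
        (∈S-≈ (stabMap f r) (transpose p₂ p₃) fr≈ fr∈S)

third-point : 3 ≤ n → (i j : Fin n) → ∃[ k ] (k ≢ i × k ≢ j)
third-point (s≤s (s≤s (s≤s _))) i j with zero ≟ i | zero ≟ j | suc zero ≟ i | suc zero ≟ j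
... | no 0≢i | no 0≢j | _        | _        = zero , 0≢i , 0≢j
... | _      | _      | no 1≢i   | no 1≢j   = suc zero , 1≢i , 1≢j
... | yes refl | _    | _        | yes refl = suc (suc zero) , (λ ()) , (λ ())
... | _    | yes refl | yes refl | _        = suc (suc zero) , (λ ()) , (λ ())
... | yes refl | _    | yes ()   | _
... | _    | yes refl | _        | yes ()

module Reconstruction (T : TranspositionSet n) (isT : IsTranspositionSet T) (generates : Generates T)
                      (n≥3 : 3 ≤ n) where
  open CayleyGraph T isT

  Closed : (Fin n → Set) → Set
  Closed X = ∀ {x y} → (x , y) ∈ T → ∀ z → X z → X (swap x y z)

  closed⇒full : {X : Fin n → Set} → Closed X → X i → ∀ k → X k
  closed⇒full {i = i} {X} X-closed Xi k with generates (transpose i k)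
  ... | w , w⊆T , ik≈w = subst X (trans (sym (ik≈w i)) (swap-fst i k)) (along w w⊆T)
    where
    along : ∀ w → (∀ {p} → p ∈ w → p ∈ T) → X (wordProd w ⟨$⟩ʳ i)
    along [] _ = Xi
    along ((x , y) ∷ w) w⊆T = X-closed (w⊆T (here refl)) _ (along w (w⊆T ∘ there))

  generator-search : (P : Sym n → Set) → (∀ σ → Dec (P σ)) → (∀ σ ρ → σ ≈ ρ → P σ → P ρ) →
    (∃[ s ] (s ∈S T × P s)) ⊎ (∀ s → s ∈S T → ¬ P s)
  generator-search P P? P-≈ with any? (λ xy → P? (transpose (proj₁ xy) (proj₂ xy))) T
  ... | yes found with find found
  ...   | (x , y) , xy∈T , P[xy] = inj₁ (transpose x y , (x , y , xy∈T , λ _ → refl) , P[xy])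
  generator-search P P? P-≈ | no none = inj₂ λ where
    s (x , y , xy∈T , s≈xy) Ps → none (lose xy∈T (P-≈ s (transpose x y) s≈xy Ps))

  some-generator-moves : (i : Fin n) → ∃[ s ] (s ∈S T × Moves s i)
  some-generator-moves i
    with generator-search (λ σ → Moves σ i) (λ σ → moves? σ i) (λ σ ρ → moves-≈ {σ = σ} {ρ})
  ... | inj₁ found = found
  ... | inj₂ none = ⊥-elim (proj₁ (proj₂ other) (closed⇒full fixed refl (proj₁ other)))
    where
    other = third-point n≥3 i i
    fixed : Closed (_≡ i)
    fixed {x} {y} xy∈T z refl =
      fixed-if-not-moved (none (transpose x y) (x , y , xy∈T , λ _ → refl))

  star-dichotomy : (s₀ : Sym n) (i : Fin n) →
    (∃[ s ] (s ∈S T × Moves s i × ¬ s ≈ s₀)) ⊎ (∀ s → s ∈S T → Moves s i → s ≈ s₀)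
  star-dichotomy s₀ i with generator-search (λ σ → Moves σ i × ¬ σ ≈ s₀) (λ σ → moves? σ i ×-dec ¬? (σ ≈? s₀))
                             (λ σ ρ σ≈ρ (σ⇝i , σ≉s₀) → moves-≈ {σ = σ} {ρ} σ≈ρ σ⇝i ,
                                                        λ ρ≈s₀ → σ≉s₀ λ k → trans (σ≈ρ k) (ρ≈s₀ k))
  ... | inj₁ (s , s∈S , s⇝i , s≉s₀) = inj₁ (s , s∈S , s⇝i , s≉s₀)
  ... | inj₂ none = inj₂ λ s s∈S s⇝i → ≈-stable s s₀ λ s≉s₀ → none s s∈S (s⇝i , s≉s₀)

  -- If s₀ = (i j) were the only generator moving i or j, the pair {i , j} would be closed under S.
  leaf-neighbour : s₀ ∈S T → Moves s₀ i → (∀ s → s ∈S T → Moves s i → s ≈ s₀) →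
    ∃[ s₁ ] (s₁ ∈S T × Moves s₁ (s₀ ⟨$⟩ʳ i) × ¬ s₁ ≈ s₀)
  leaf-neighbour {s₀ = s₀} {i} s₀∈S s₀⇝i only-at-i with star-dichotomy s₀ (s₀ ⟨$⟩ʳ i)
  ... | inj₁ found = found
  ... | inj₂ only-at-j₀ = ⊥-elim (outside (closed⇒full pair-closed (inj₁ refl) k₀))
    where
    j₀ = s₀ ⟨$⟩ʳ i
    s₀-tr = generator-transposition s₀ s₀∈S
    k₀ = proj₁ (third-point n≥3 i j₀)
    outside : ¬ (k₀ ≡ i ⊎ k₀ ≡ j₀)
    outside (inj₁ k₀≡i) = proj₁ (proj₂ (third-point n≥3 i j₀)) k₀≡i
    outside (inj₂ k₀≡j₀) = proj₂ (proj₂ (third-point n≥3 i j₀)) k₀≡j₀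
    pair-closed : Closed (λ z → z ≡ i ⊎ z ≡ j₀)
    pair-closed {x} {y} xy∈T z z∈ij with moves? (transpose x y) z
    ... | no xy↛z = subst (λ w → w ≡ i ⊎ w ≡ j₀) (sym (fixed-if-not-moved xy↛z)) z∈ij
    pair-closed {x} {y} xy∈T z (inj₁ refl) | yes xy⇝i =
      inj₂ (only-at-i (transpose x y) (x , y , xy∈T , λ _ → refl) xy⇝i i)
    pair-closed {x} {y} xy∈T z (inj₂ refl) | yes xy⇝j₀ =
      inj₁ (trans (only-at-j₀ (transpose x y) (x , y , xy∈T , λ _ → refl) xy⇝j₀ j₀)
                  (transposition-involutive s₀-tr i))

  record Corresponds (g : Sym n → Sym n) (i p : Fin n) : Set where
    field
      forward  : ∀ s → s ∈S T → Moves s i → Moves (g s) p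
      backward : ∀ s → s ∈S T → Moves (g s) p → Moves s i

  open Corresponds

  corresponds-inverse : (f : StabAut T) → Corresponds (stabMap f) i p → Corresponds (stabInv f) p i
  corresponds-inverse f C = record
    { forward = λ s s∈S s⇝p →
        backward C (stabInv f s) (stab-maps-S (inverse f) s s∈S) (moves-≈ {σ = s} (λ k → sym (to-from F s k)) s⇝p)
    ; backward = λ s s∈S f⁻¹s⇝i →
        moves-≈ {ρ = s} (to-from F s) (forward C (stabInv f s) (stab-maps-S (inverse f) s s∈S) f⁻¹s⇝i)
    }
    where F = perm (aut f)

  -- Two corresponding points p ≠ q force f s₀ = (p q) for every generator s₀ at i, so i is a leaf;
  -- its neighbouring generator s₁ then has an image meeting (p q), and so s₁ would be at i too.
  corresponds-unique : (f : StabAut T) → Corresponds (stabMap f) i p → Corresponds (stabMap f) i q → p ≡ q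
  corresponds-unique {i = i} {p} {q} f Cp Cq with p ≟ q
  ... | yes p≡q = p≡q
  ... | no p≢q with some-generator-moves i
  ...   | s₀ , s₀∈S , s₀⇝i = ⊥-elim (neighbour-at-i (leaf-neighbour s₀∈S s₀⇝i only-s₀))
    where
    fs₀≈pq : stabMap f s₀ ≈ transpose p q
    fs₀≈pq = transposition-determined (image-transposition f s₀ s₀∈S)
               (forward Cp s₀ s₀∈S s₀⇝i) (forward Cq s₀ s₀∈S s₀⇝i) p≢q

    only-s₀ : ∀ s → s ∈S T → Moves s i → s ≈ s₀
    only-s₀ s s∈S s⇝i = ≈-stable s s₀ λ s≉s₀ → p≢q
      (common-point-unique (image-transposition f s s∈S) (image-transposition f s₀ s₀∈S) (image-≉ f s s₀ s≉s₀)
        (forward Cp s s∈S s⇝i) (forward Cp s₀ s₀∈S s₀⇝i) (forward Cq s s∈S s⇝i) (forward Cq s₀ s₀∈S s₀⇝i))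

    neighbour-at-i : ∃[ s₁ ] (s₁ ∈S T × Moves s₁ (s₀ ⟨$⟩ʳ i) × ¬ s₁ ≈ s₀) → ⊥
    neighbour-at-i (s₁ , s₁∈S , s₁⇝j , s₁≉s₀)
      with image-meet f s₀∈S s₁∈S (λ s₀≈s₁ → s₁≉s₀ λ k → sym (s₀≈s₁ k))
             (transposition-moves-image (generator-transposition s₀ s₀∈S) s₀⇝i) s₁⇝j
    ... | w , fs₀⇝w , fs₁⇝w with transpose-moves (moves-≈ {σ = stabMap f s₀} fs₀≈pq fs₀⇝w)
    ...   | inj₁ refl = s₁≉s₀ (only-s₀ s₁ s₁∈S (backward Cp s₁ s₁∈S fs₁⇝w))
    ...   | inj₂ refl = s₁≉s₀ (only-s₀ s₁ s₁∈S (backward Cq s₁ s₁∈S fs₁⇝w))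

  branch-forward : (f : StabAut T) {s₁ : Sym n} → s₀ ∈S T → s₁ ∈S T → ¬ s₀ ≈ s₁ → Moves s₀ i → Moves s₁ i →
    Moves (stabMap f s₀) p → Moves (stabMap f s₁) p → ∀ s → s ∈S T → Moves s i → Moves (stabMap f s) p
  branch-forward {s₀ = s₀} f {s₁} s₀∈S s₁∈S s₀≉s₁ s₀⇝i s₁⇝i fs₀⇝p fs₁⇝p s s∈S s⇝i with s ≈? s₀ | s ≈? s₁
  ... | yes s≈s₀ | _ = moves-≈ {σ = stabMap f s₀} (to-cong (perm (aut f)) λ k → sym (s≈s₀ k)) fs₀⇝p
  ... | no _ | yes s≈s₁ = moves-≈ {σ = stabMap f s₁} (to-cong (perm (aut f)) λ k → sym (s≈s₁ k)) fs₁⇝p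
  ... | no s≉s₀ | no s≉s₁
    with image-star f s₀∈S s₁∈S s∈S s₀≉s₁ (λ s₀≈s → s≉s₀ λ k → sym (s₀≈s k)) (λ s₁≈s → s≉s₁ λ k → sym (s₁≈s k))
           s₀⇝i s₁⇝i s⇝i
  ...   | q , fs₀⇝q , fs₁⇝q , fs⇝q =
    subst (Moves (stabMap f s))
      (sym (common-point-unique (image-transposition f s₀ s₀∈S) (image-transposition f s₁ s₁∈S)
                                       (image-≉ f s₀ s₁ s₀≉s₁) fs₀⇝p fs₁⇝p fs₀⇝q fs₁⇝q)) fs⇝q

  -- At a branch point i the correspondence is symmetric: the images f s₀ , f s₁ form a branch at p for f⁻¹.
  branch-correspondence : (f : StabAut T) {s₁ : Sym n} → s₀ ∈S T → s₁ ∈S T → ¬ s₀ ≈ s₁ →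
    Moves s₀ i → Moves s₁ i → ∃[ p ] Corresponds (stabMap f) i p
  branch-correspondence {s₀ = s₀} {i} f {s₁} s₀∈S s₁∈S s₀≉s₁ s₀⇝i s₁⇝i
    with image-meet f s₀∈S s₁∈S s₀≉s₁ s₀⇝i s₁⇝i
  ... | p , fs₀⇝p , fs₁⇝p = p , record
    { forward = branch-forward f s₀∈S s₁∈S s₀≉s₁ s₀⇝i s₁⇝i fs₀⇝p fs₁⇝p
    ; backward = λ s s∈S fs⇝p → moves-≈ {ρ = s} (from-to F s)
        (branch-forward (inverse f) (stab-maps-S f s₀ s₀∈S) (stab-maps-S f s₁ s₁∈S) (image-≉ f s₀ s₁ s₀≉s₁)
          fs₀⇝p fs₁⇝p (back s₀ s₀⇝i) (back s₁ s₁⇝i) (stabMap f s) (stab-maps-S f s s∈S) fs⇝p)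
    }
    where
    F = perm (aut f)
    back : ∀ σ → Moves σ i → Moves (stabInv f (stabMap f σ)) i
    back σ = moves-≈ {σ = σ} λ k → sym (from-to F σ k)

  -- At a leaf i with unique generator s₀ = (i j₀), p is the endpoint of f s₀ not shared with the image of
  -- a further generator s₁ at j₀.
  module Leaf (f : StabAut T) {i : Fin n} {s₀ s₁ : Sym n} (s₀∈S : s₀ ∈S T) (s₀⇝i : Moves s₀ i)
              (only-s₀ : ∀ s → s ∈S T → Moves s i → s ≈ s₀)
              (s₁∈S : s₁ ∈S T) (s₁⇝j₀ : Moves s₁ (s₀ ⟨$⟩ʳ i)) (s₁≉s₀ : ¬ s₁ ≈ s₀)
              {q₀ : Fin n} (fs₀⇝q₀ : Moves (stabMap f s₀) q₀) (fs₁⇝q₀ : Moves (stabMap f s₁) q₀) where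
    private
      F = perm (aut f)
      j₀ = s₀ ⟨$⟩ʳ i
      s₀-tr = generator-transposition s₀ s₀∈S
      s₀⇝j₀ = transposition-moves-image s₀-tr s₀⇝i
      fs₀∈S = stab-maps-S f s₀ s₀∈S
      fs₀-tr = image-transposition f s₀ s₀∈S
      s₀≉s₁ : ¬ s₀ ≈ s₁
      s₀≉s₁ s₀≈s₁ = s₁≉s₀ λ k → sym (s₀≈s₁ k)
      p₀ = (stabMap f s₀) ⟨$⟩ʳ q₀
      fs₀⇝p₀ = transposition-moves-image fs₀-tr fs₀⇝q₀
      ≉s₀ : ∀ {s} → ¬ Moves s i → ¬ s ≈ s₀
      ≉s₀ s↛i s≈s₀ = s↛i (moves-≈ {σ = s₀} (λ k → sym (s≈s₀ k)) s₀⇝i)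

      leaf-forward : ∀ s → s ∈S T → Moves s i → Moves (stabMap f s) p₀
      leaf-forward s s∈S s⇝i = moves-≈ {σ = (stabMap f s₀)} (to-cong F λ k → sym (only-s₀ s s∈S s⇝i k)) fs₀⇝p₀

      moves-j₀ : ∀ s → s ∈S T → ¬ Moves s i → Moves (stabMap f s) p₀ → Moves s j₀
      moves-j₀ s s∈S s↛i fs⇝p₀
        with image-meet (inverse f) (stab-maps-S f s s∈S) fs₀∈S (image-≉ f s s₀ (≉s₀ s↛i)) fs⇝p₀ fs₀⇝p₀
      ... | w , f⁻¹fs⇝w , f⁻¹fs₀⇝w
        with transpose-moves (moves-≈ {σ = s₀} (transposition-at s₀-tr s₀⇝i)
                               (moves-≈ {ρ = s₀} (from-to F s₀) f⁻¹fs₀⇝w))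
      ...   | inj₁ w≡i = ⊥-elim (s↛i (subst (Moves s) w≡i (moves-≈ {ρ = s} (from-to F s) f⁻¹fs⇝w)))
      ...   | inj₂ w≡j₀ = subst (Moves s) w≡j₀ (moves-≈ {ρ = s} (from-to F s) f⁻¹fs⇝w)

      moves-q₀ : ∀ s → s ∈S T → ¬ Moves s i → Moves (stabMap f s) p₀ → Moves (stabMap f s) q₀
      moves-q₀ s s∈S s↛i fs⇝p₀ with s ≈? s₁
      ... | yes s≈s₁ = moves-≈ {σ = (stabMap f s₁)} (to-cong F λ k → sym (s≈s₁ k)) fs₁⇝q₀
      ... | no s≉s₁
        with image-star f s₀∈S s₁∈S s∈S s₀≉s₁ (λ s₀≈s → ≉s₀ s↛i λ k → sym (s₀≈s k)) (λ s₁≈s → s≉s₁ λ k → sym (s₁≈s k))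
               s₀⇝j₀ s₁⇝j₀ (moves-j₀ s s∈S s↛i fs⇝p₀)
      ...   | r , fs₀⇝r , fs₁⇝r , fs⇝r =
        subst (Moves (stabMap f s))
          (sym (common-point-unique fs₀-tr (image-transposition f s₁ s₁∈S) (image-≉ f s₀ s₁ s₀≉s₁)
                                     fs₀⇝q₀ fs₁⇝q₀ fs₀⇝r fs₁⇝r)) fs⇝r

      leaf-backward : ∀ s → s ∈S T → Moves (stabMap f s) p₀ → Moves s i
      leaf-backward s s∈S fs⇝p₀ with moves? s i
      ... | yes s⇝i = s⇝i
      ... | no s↛i = ⊥-elim (moved fs₀⇝q₀ (common-point-unique (image-transposition f s s∈S) fs₀-tr
                                           (image-≉ f s s₀ (≉s₀ s↛i)) fs⇝p₀ fs₀⇝p₀ (moves-q₀ s s∈S s↛i fs⇝p₀) fs₀⇝q₀))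

    correspondence : ∃[ p₀ ] Corresponds (stabMap f) i p₀
    correspondence = p₀ , record { forward = leaf-forward ; backward = leaf-backward }

  corresponds-exists : (f : StabAut T) (i : Fin n) → ∃[ p ] Corresponds (stabMap f) i p
  corresponds-exists f i with some-generator-moves i
  ... | s₀ , s₀∈S , s₀⇝i with star-dichotomy s₀ i
  ...   | inj₁ (s₁ , s₁∈S , s₁⇝i , s₁≉s₀) =
    branch-correspondence f s₀∈S s₁∈S (λ s₀≈s₁ → s₁≉s₀ λ k → sym (s₀≈s₁ k)) s₀⇝i s₁⇝i
  ...   | inj₂ only-s₀ with leaf-neighbour s₀∈S s₀⇝i only-s₀
  ...     | s₁ , s₁∈S , s₁⇝j₀ , s₁≉s₀
    with image-meet f s₀∈S s₁∈S (λ s₀≈s₁ → s₁≉s₀ λ k → sym (s₀≈s₁ k))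
           (transposition-moves-image (generator-transposition s₀ s₀∈S) s₀⇝i) s₁⇝j₀
  ...       | q₀ , fs₀⇝q₀ , fs₁⇝q₀ = Leaf.correspondence f s₀∈S s₀⇝i only-s₀ s₁∈S s₁⇝j₀ s₁≉s₀ fs₀⇝q₀ fs₁⇝q₀

  module Induced (f : StabAut T) where
    private
      F = perm (aut f)

    -- Opaque, since unfolding π would run the whole search of corresponds-exists during type checking.
    opaque
      π : Fin n → Fin n
      π i = proj₁ (corresponds-exists f i)

      π⁻¹ : Fin n → Fin n
      π⁻¹ p = proj₁ (corresponds-exists (inverse f) p)

      π-corresponds : ∀ i → Corresponds (stabMap f) i (π i)
      π-corresponds i = proj₂ (corresponds-exists f i)

      π⁻¹-corresponds : ∀ p → Corresponds (stabInv f) p (π⁻¹ p)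
      π⁻¹-corresponds p = proj₂ (corresponds-exists (inverse f) p)

    point-permutation : Sym n
    point-permutation = permutation π π⁻¹
      (λ p → corresponds-unique f (π-corresponds (π⁻¹ p)) (corresponds-inverse (inverse f) (π⁻¹-corresponds p)))
      (λ i → corresponds-unique (inverse f) (π⁻¹-corresponds (π i)) (corresponds-inverse f (π-corresponds i)))

    agrees-on-generators : ∀ s → s ∈S T → stabMap f s ≈ conjugate point-permutation s
    agrees-on-generators s s∈S@(x , y , _ , s≈xy) k = begin
      stabMap f s ⟨$⟩ʳ k                                ≡⟨ fs≈ k ⟩
      swap (π x) (π y) k                                ≡⟨ sym (swap-conjugate point-permutation x y k) ⟩
      conjugate point-permutation (transpose x y) ⟨$⟩ʳ k ≡⟨ cong (point-permutation ⟨$⟩ʳ_) (sym (s≈xy _)) ⟩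
      conjugate point-permutation s ⟨$⟩ʳ k               ∎
      where
      open ≡-Reasoning
      s-tr = generator-transposition s s∈S
      πx≢πy : π x ≢ π y
      πx≢πy πx≡πy = Tr.fst≢snd s-tr
        (trans (sym (inverseˡ point-permutation)) (trans (cong π⁻¹ πx≡πy) (inverseˡ point-permutation)))
      fs≈ : stabMap f s ≈ transpose (π x) (π y)
      fs≈ = transposition-determined (image-transposition f s s∈S)
              (Corresponds.forward (π-corresponds x) s s∈S (transposition-moves-fst s-tr))
              (Corresponds.forward (π-corresponds y) s s∈S (transposition-moves-snd s-tr)) πx≢πy

    groupAut : GroupAutS T
    groupAut = record
      { gperm = conjugation point-permutation
      ; hom = conjugate-hom point-permutation
      ; maps-S = λ s s∈S →
          ∈S-≈ (stabMap f s) (conjugate point-permutation s) (agrees-on-generators s s∈S) (stab-maps-S f s s∈S)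
      ; onto-S = λ s s∈S → stabInv f s , stab-maps-S (inverse f) s s∈S ,
                   λ k → trans (sym (agrees-on-generators (stabInv f s) (stab-maps-S (inverse f) s s∈S) k))
                               (to-from F s k)
      }

    localAut : LocalAut T
    localAut = record
      { stab = f ∘ˢ inverse (groupAut⇒stabAut groupAut)
      ; fix-S = λ s s∈S k →
          trans (agrees-on-generators (from A s) (groupAut-inverse-maps-S groupAut s s∈S) k) (to-from A s k)
      }
      where A = conjugation point-permutation

    factorisation : ∀ σ → stabMap f σ ≈ localMap localAut (gautMap groupAut σ)
    factorisation σ = to-cong F {σ} {from A (to A σ)} λ k → sym (from-to A σ k)
      where A = conjugation point-permutation

  stabiliser-factorisation : (f : StabAut T) →
    ∃[ l ] ∃[ α ] (∀ σ → stabMap f σ ≈ localMap {T = T} l (gautMap {T = T} α σ))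
  stabiliser-factorisation f = localAut , groupAut , factorisation
    where open Induced f

mainTheorem2 : (n : ℕ) → n ≥ 5 → (T : TranspositionSet n) → IsTranspositionSet T → Generates T →
    ((f : StabAut T) (l : LocalAut T) →
       (stabMap f (localMap l (stabInv f id)) ≈ id)
       × (∀ s → s ∈S T → stabMap f (localMap l (stabInv f s)) ≈ s))
    × ((f : StabAut T) → ∃[ l ] ∃[ a ] (∀ x → stabMap f x ≈ localMap {T = T} l (gautMap {T = T} a x)))
    × ((l : LocalAut T) (a : GroupAutS T) → (∀ x → localMap l x ≈ gautMap a x) → ∀ x → localMap l x ≈ x)
mainTheorem2 n n≥5 T isT generates =
  local-normal , stabiliser-factorisation , local∩groupAut-trivial generates
  where
  open CayleyGraph T isT
  open Reconstruction T isT generates (≤-trans (s≤s (s≤s (s≤s z≤n))) n≥5)
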